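{- Let $\delta>0$ and let $t,n$ be positive integers. If an edge-coloring of the complete graph $K_n$ satisfies $d_i(x)\le \delta n$ for every vertex $x$ and every color $i$, then this coloring has at most $\frac{5}{8}\delta t^4\binom{n}{t}$ copies of $K_t$ that are not rainbow.
   Context: For an edge-coloring of $K_n$, a vertex $x$ and a color $i$, $d_i(x)$ denotes the number of edges of color $i$ incident to $x$. A copy of $K_t$ is rainbow if all of its $\binom{t}{2}$ edges receive distinct colors.
   Formalization: The parameter δ ranges over the positive rationals. -}

module Defs where

open import Data.Nat as ℕ using (ℕ)
open import Data.Fin as Fin using (Fin)
open import Data.Fin.Subset using (Subset; _∈_; ∣_∣)
open import Data.List using (List; length; filter)
open import Data.Fin.Base using () renaming (_<_ to _<ᶠ_)
open import Data.Fin.Properties using (_≟_)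
open import Data.List.Base using () 
import Data.Nat.Properties as ℕP
open import Data.Product using (Σ; _×_; ∃-syntax)
open import Relation.Nullary using (¬_)
open import Relation.Nullary.Decidable using (_×-dec_; ¬?)
open import Relation.Binary.PropositionalEquality using (_≡_)
open import Data.Integer using (+_)
open import Data.Rational using (ℚ; _/_)

-- An edge-coloring of K_n with colors in ℕ: a symmetric function on pairs of
-- vertices (its values on the diagonal are irrelevant).
record EdgeColoring (n : ℕ) : Set where
  field
    col  : Fin n → Fin n → ℕ
    symm : ∀ x y → col x y ≡ col y x
open EdgeColoring public

vertices : (n : ℕ) → List (Fin n)
vertices n = Data.List.Base.allFin n

deg : ∀ {n} → EdgeColoring n → Fin n → ℕ → ℕ
deg {n} c x i =
  length (filter (λ y → ¬? (y ≟ x) ×-dec (col c x y ℕP.≟ i)) (vertices n))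

IsKt : ∀ {n} → ℕ → Subset n → Set
IsKt t S = ∣ S ∣ ≡ t

EdgeOf : ∀ {n} → Subset n → Fin n → Fin n → Set
EdgeOf S a b = a ∈ S × b ∈ S × a <ᶠ b

Rainbow : ∀ {n} → EdgeColoring n → Subset n → Set
Rainbow c S = ∀ a b a' b' → EdgeOf S a b → EdgeOf S a' b' →
              col c a b ≡ col c a' b' → (a ≡ a' × b ≡ b')

ℕtoℚ : ℕ → ℚ
ℕtoℚ k = (+ k) / 1

module Submission where

-- A copy of K_t that is not rainbow has two distinct edges of the same colour. If they share a
-- vertex they span a monochromatic cherry on 3 vertices, otherwise a monochromatic matching on
-- 4 vertices. With D the largest degree d_i(x), there are at most n(n-1)D cherries and
-- n(n-1)nD/2 matchings, and a fixed k-set lies in at most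
-- C(n-k,t-k) = C(n,t) t(t-1)⋯(t-k+1) / n(n-1)⋯(n-k+1) copies of K_t. Since (t-m)/(n-m) ≤ t/n,
-- summing over the witnesses gives 8n·#{non-rainbow K_t} ≤ (4t³(t-1) + 8t²(t-1)) D C(n,t)
-- ≤ 5t⁴ D C(n,t), and D ≤ δn.

module FallingFactorial where

  open import Data.Nat
  open import Data.Nat.Properties
  open import Data.Nat.Combinatorics using (_C_; nCk+nC[k+1]≡[n+1]C[k+1]; nC1≡n; k>n⇒nCk≡0)
  open import Data.Product using (_,_)
  open import Relation.Binary.PropositionalEquality
  open import Algebra.Properties.CommutativeSemigroup *-commutativeSemigroup
    using (interchange; x∙yz≈yx∙z; x∙yz≈y∙xz)

  -- Falling factorial n (n-1) ⋯ (n-k+1); truncated subtraction makes it 0 for k > n.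
  infixl 8 _↓_

  _↓_ : ℕ → ℕ → ℕ
  n ↓ zero  = 1
  n ↓ suc k = n * (n ∸ 1) ↓ k

  ↓-+ : ∀ n i j → n ↓ (i + j) ≡ n ↓ i * (n ∸ i) ↓ j
  ↓-+ n zero    j = sym (*-identityˡ (n ↓ j))
  ↓-+ n (suc i) j = begin
    n * (n ∸ 1) ↓ (i + j)                ≡⟨ cong (n *_) (↓-+ (n ∸ 1) i j) ⟩
    n * ((n ∸ 1) ↓ i * (n ∸ 1 ∸ i) ↓ j)  ≡⟨ cong (λ m → n * ((n ∸ 1) ↓ i * m ↓ j)) (∸-+-assoc n 1 i) ⟩
    n * ((n ∸ 1) ↓ i * (n ∸ suc i) ↓ j)  ≡⟨ *-assoc n _ _ ⟨
    n * (n ∸ 1) ↓ i * (n ∸ suc i) ↓ j    ∎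
    where open ≡-Reasoning

  ↓-nonZero : ∀ {k n} → k ≤ n → NonZero (n ↓ k)
  ↓-nonZero z≤n = _
  ↓-nonZero {suc k} {suc n} (s≤s k≤n) = m*n≢0 (suc n) (n ↓ k) {{_}} {{↓-nonZero k≤n}}

  [1+k]*[1+n]C[1+k]≡[1+n]*nCk : ∀ n k → suc k * (suc n C suc k) ≡ suc n * (n C k)
  [1+k]*[1+n]C[1+k]≡[1+n]*nCk n zero = trans (*-identityˡ _) (trans (nC1≡n (suc n)) (sym (*-identityʳ (suc n))))
  [1+k]*[1+n]C[1+k]≡[1+n]*nCk zero (suc k)
    rewrite k>n⇒nCk≡0 {1} {suc (suc k)} (s≤s (s≤s z≤n)) | k>n⇒nCk≡0 {0} {suc k} (s≤s z≤n) = *-zeroʳ (suc (suc k))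
  [1+k]*[1+n]C[1+k]≡[1+n]*nCk (suc n) (suc k) = begin
    suc (suc k) * (suc (suc n) C suc (suc k))
      ≡⟨ cong (suc (suc k) *_) (nCk+nC[k+1]≡[n+1]C[k+1] (suc n) (suc k)) ⟨
    suc (suc k) * (A + suc n C suc (suc k))
      ≡⟨ *-distribˡ-+ (suc (suc k)) A _ ⟩
    A + suc k * A + suc (suc k) * (suc n C suc (suc k))
      ≡⟨ cong₂ (λ x y → A + x + y) ([1+k]*[1+n]C[1+k]≡[1+n]*nCk n k) ([1+k]*[1+n]C[1+k]≡[1+n]*nCk n (suc k)) ⟩
    A + suc n * (n C k) + suc n * (n C suc k)
      ≡⟨ trans (cong (A +_) (*-distribˡ-+ (suc n) (n C k) _)) (sym (+-assoc A _ _)) ⟨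
    A + suc n * (n C k + n C suc k)
      ≡⟨ cong (λ x → A + suc n * x) (nCk+nC[k+1]≡[n+1]C[k+1] n k) ⟩
    suc (suc n) * A ∎
    where
    open ≡-Reasoning
    A : ℕ
    A = suc n C suc k

  [k+n]C[k+t]*[k+t]↓k≡nCt*[k+n]↓k : ∀ k n t → ((k + n) C (k + t)) * (k + t) ↓ k ≡ (n C t) * (k + n) ↓ k
  [k+n]C[k+t]*[k+t]↓k≡nCt*[k+n]↓k zero    n t = refl
  [k+n]C[k+t]*[k+t]↓k≡nCt*[k+n]↓k (suc k) n t = begin
    (suc (k + n) C suc (k + t)) * (suc (k + t) * (k + t) ↓ k)
      ≡⟨ x∙yz≈yx∙z (suc (k + n) C suc (k + t)) (suc (k + t)) ((k + t) ↓ k) ⟩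
    suc (k + t) * (suc (k + n) C suc (k + t)) * (k + t) ↓ k
      ≡⟨ cong (_* (k + t) ↓ k) ([1+k]*[1+n]C[1+k]≡[1+n]*nCk (k + n) (k + t)) ⟩
    suc (k + n) * ((k + n) C (k + t)) * (k + t) ↓ k
      ≡⟨ *-assoc (suc (k + n)) ((k + n) C (k + t)) ((k + t) ↓ k) ⟩
    suc (k + n) * (((k + n) C (k + t)) * (k + t) ↓ k)
      ≡⟨ cong (suc (k + n) *_) ([k+n]C[k+t]*[k+t]↓k≡nCt*[k+n]↓k k n t) ⟩
    suc (k + n) * ((n C t) * (k + n) ↓ k)
      ≡⟨ x∙yz≈y∙xz (suc (k + n)) (n C t) ((k + n) ↓ k) ⟩
    (n C t) * (suc (k + n) * (k + n) ↓ k) ∎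
    where open ≡-Reasoning

  m*[n∸o]≤n*[m∸o] : ∀ {m n} o → n ≤ m → m * (n ∸ o) ≤ n * (m ∸ o)
  m*[n∸o]≤n*[m∸o] {m} {n} o n≤m = begin
    m * (n ∸ o)   ≡⟨ *-distribˡ-∸ m n o ⟩
    m * n ∸ m * o ≤⟨ ∸-monoʳ-≤ (m * n) (*-monoˡ-≤ o n≤m) ⟩
    m * n ∸ n * o ≡⟨ cong (_∸ n * o) (*-comm m n) ⟩
    n * m ∸ n * o ≡⟨ *-distribˡ-∸ n m o ⟨
    n * (m ∸ o)   ∎
    where open ≤-Reasoning

  m^k*[n∸o]↓k≤n^k*[m∸o]↓k : ∀ {m n} → n ≤ m → ∀ k o → m ^ k * (n ∸ o) ↓ k ≤ n ^ k * (m ∸ o) ↓ k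
  m^k*[n∸o]↓k≤n^k*[m∸o]↓k n≤m zero    o = ≤-refl
  m^k*[n∸o]↓k≤n^k*[m∸o]↓k {m} {n} n≤m (suc k) o = begin
    m * m ^ k * ((n ∸ o) * (n ∸ o ∸ 1) ↓ k)
      ≡⟨ interchange m _ _ _ ⟩
    m * (n ∸ o) * (m ^ k * (n ∸ o ∸ 1) ↓ k)
      ≡⟨ cong (λ x → m * (n ∸ o) * (m ^ k * x ↓ k)) (∸-+-assoc n o 1) ⟩
    m * (n ∸ o) * (m ^ k * (n ∸ (o + 1)) ↓ k)
      ≤⟨ *-mono-≤ (m*[n∸o]≤n*[m∸o] o n≤m) (m^k*[n∸o]↓k≤n^k*[m∸o]↓k n≤m k (o + 1)) ⟩
    n * (m ∸ o) * (n ^ k * (m ∸ (o + 1)) ↓ k)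
      ≡⟨ cong (λ x → n * (m ∸ o) * (n ^ k * x ↓ k)) (∸-+-assoc m o 1) ⟨
    n * (m ∸ o) * (n ^ k * (m ∸ o ∸ 1) ↓ k)
      ≡⟨ interchange n _ _ _ ⟩
    n * n ^ k * ((m ∸ o) * (m ∸ o ∸ 1) ↓ k) ∎
    where open ≤-Reasoning

  ≤[n∸k]C[t∸k]⇒*n↓k≤nCt*t↓k : ∀ {ℓ k n t} → k ≤ n → k ≤ t → ℓ ≤ (n ∸ k) C (t ∸ k) →
                               ℓ * n ↓ k ≤ (n C t) * t ↓ k
  ≤[n∸k]C[t∸k]⇒*n↓k≤nCt*t↓k {ℓ} {k} k≤n k≤t ℓ≤ with m≤n⇒∃[o]m+o≡n k≤n | m≤n⇒∃[o]m+o≡n k≤t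
  ... | m , refl | r , refl = begin
    ℓ * (k + m) ↓ k
      ≤⟨ *-monoˡ-≤ ((k + m) ↓ k) (subst₂ (λ a b → ℓ ≤ a C b) (m+n∸m≡n k m) (m+n∸m≡n k r) ℓ≤) ⟩
    (m C r) * (k + m) ↓ k
      ≡⟨ [k+n]C[k+t]*[k+t]↓k≡nCt*[k+n]↓k k m r ⟨
    ((k + m) C (k + r)) * (k + r) ↓ k ∎
    where open ≤-Reasoning


module ListProperties where

  open import Data.Nat using (suc; _+_; _*_; _≤_; z≤n)
  open import Data.Nat.Properties using (+-suc; ≤-trans; ≤-reflexive; +-mono-≤)
  open import Data.List using (List; []; _∷_; length; map; filter; concatMap)
  open import Data.List.Properties using (length-++)
  open import Data.List.Membership.Propositional using (_∈_)
  open import Data.List.Membership.Propositional.Properties using (∈-map⁺; ∈-concat⁺′)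
  open import Data.List.Relation.Unary.All as All using (All; []; _∷_)
  import Data.List.Relation.Unary.All.Properties as All
  open import Relation.Nullary using (¬_; yes; no; contradiction)
  open import Relation.Unary using (Decidable)
  open import Relation.Unary.Properties using (∁?)
  open import Relation.Binary.PropositionalEquality

  length-filter+filter-∁ : ∀ {A : Set} {P : A → Set} (P? : Decidable P) xs →
                           length (filter P? xs) + length (filter (∁? P?) xs) ≡ length xs
  length-filter+filter-∁ P? []       = refl
  length-filter+filter-∁ P? (x ∷ xs) with P? x
  ... | yes _ = cong suc (length-filter+filter-∁ P? xs)
  ... | no  _ = trans (+-suc _ _) (cong suc (length-filter+filter-∁ P? xs))

  All-⊥⇒length≡0 : ∀ {A : Set} {P : A → Set} {xs} → (∀ {x} → ¬ P x) → All P xs → length xs ≡ 0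
  All-⊥⇒length≡0 ¬P []      = refl
  All-⊥⇒length≡0 ¬P (p ∷ _) = contradiction p ¬P

  length-concatMap-≤ : ∀ {A B : Set} (f : A → List B) {b} xs → (∀ x → length (f x) ≤ b) →
                       length (concatMap f xs) ≤ length xs * b
  length-concatMap-≤ f []       _ = z≤n
  length-concatMap-≤ f (x ∷ xs) h = ≤-trans (≤-reflexive (length-++ (f x))) (+-mono-≤ (h x) (length-concatMap-≤ f xs h))

  ∈-concatMap⁺ : ∀ {A B : Set} {f : A → List B} {x y xs} → y ∈ f x → x ∈ xs → y ∈ concatMap f xs
  ∈-concatMap⁺ {f = f} y∈fx x∈xs = ∈-concat⁺′ y∈fx (∈-map⁺ f x∈xs)

  All-concatMap⁺ : ∀ {A B : Set} {P : B → Set} (f : A → List B) xs → (∀ x → All P (f x)) → All P (concatMap f xs)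
  All-concatMap⁺ f xs h = All.concat⁺ {xss = map f xs} (All.map⁺ (All.tabulate (λ {x} _ → h x)))


module Subsets where

  open import Data.Nat using (_+_; _≤_; z≤n; s≤s)
  open import Data.Nat.Properties using (≤-trans; ≤-reflexive; ≤-antisym; n≤1+n; +-suc; +-mono-≤)
  open import Data.Bool using (true; false)
  open import Data.Fin using (Fin)
  open import Data.Fin.Subset using (Subset; ∣_∣; _∈_; _⊆_; _∪_; ⁅_⁆; ⋃; _-_)
  open import Data.Fin.Subset.Properties
  open import Data.Vec using (_∷_; [])
  open import Data.List using (List; []; _∷_; length; map)
  open import Data.List.Membership.Propositional using () renaming (_∈_ to _∈ₗ_)
  open import Data.List.Relation.Unary.Any using (here; there)
  open import Data.List.Relation.Unary.All as All using (All; []; _∷_)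
  open import Data.List.Relation.Unary.AllPairs using ([]; _∷_)
  open import Data.List.Relation.Unary.Unique.Propositional using (Unique)
  open import Data.Product using (_,_)
  open import Data.Sum using (inj₁; inj₂)
  open import Function using (_∘′_)
  open import Relation.Binary.PropositionalEquality

  ∣p∪q∣≤∣p∣+∣q∣ : ∀ {n} (p q : Subset n) → ∣ p ∪ q ∣ ≤ ∣ p ∣ + ∣ q ∣
  ∣p∪q∣≤∣p∣+∣q∣ []          []          = z≤n
  ∣p∪q∣≤∣p∣+∣q∣ (true  ∷ p) (true  ∷ q) = s≤s (≤-trans (∣p∪q∣≤∣p∣+∣q∣ p q) (≤-trans (n≤1+n _) (≤-reflexive (sym (+-suc _ _)))))
  ∣p∪q∣≤∣p∣+∣q∣ (true  ∷ p) (false ∷ q) = s≤s (∣p∪q∣≤∣p∣+∣q∣ p q)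
  ∣p∪q∣≤∣p∣+∣q∣ (false ∷ p) (true  ∷ q) = ≤-trans (s≤s (∣p∪q∣≤∣p∣+∣q∣ p q)) (≤-reflexive (sym (+-suc _ _)))
  ∣p∪q∣≤∣p∣+∣q∣ (false ∷ p) (false ∷ q) = ∣p∪q∣≤∣p∣+∣q∣ p q

  Unique∧All∈⇒length≤∣p∣ : ∀ {n} {xs : List (Fin n)} (p : Subset n) → Unique xs → All (_∈ p) xs →
                           length xs ≤ ∣ p ∣
  Unique∧All∈⇒length≤∣p∣ p []          []          = z≤n
  Unique∧All∈⇒length≤∣p∣ {xs = x ∷ xs} p (x∉xs ∷ u) (x∈p ∷ xs⊆p) =
    ≤-trans (s≤s (Unique∧All∈⇒length≤∣p∣ (p - x) u xs⊆p-x)) (x∈p⇒∣p-x∣<∣p∣ x∈p)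
    where
    xs⊆p-x : All (_∈ p - x) xs
    xs⊆p-x = All.zipWith (λ (y∈p , x≢y) → x∈p∧x≢y⇒x∈p-y y∈p (x≢y ∘′ sym)) (xs⊆p , x∉xs)

  fromList : ∀ {n} → List (Fin n) → Subset n
  fromList xs = ⋃ (map ⁅_⁆ xs)

  ∈-fromList⁺ : ∀ {n} {x : Fin n} {xs} → x ∈ₗ xs → x ∈ fromList xs
  ∈-fromList⁺ {x = x} (here refl) = p⊆p∪q _ (x∈⁅x⁆ x)
  ∈-fromList⁺ {xs = y ∷ _} (there x∈xs) = q⊆p∪q ⁅ y ⁆ _ (∈-fromList⁺ x∈xs)

  fromList-⊆ : ∀ {n} {xs : List (Fin n)} {p} → All (_∈ p) xs → fromList xs ⊆ p
  fromList-⊆ []                = ⊆-min _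
  fromList-⊆ {xs = x ∷ xs} {p} (x∈p ∷ xs⊆p) y∈ with x∈p∪q⁻ ⁅ x ⁆ (fromList xs) y∈
  ... | inj₁ y∈⁅x⁆ = subst (_∈ p) (sym (x∈⁅y⁆⇒x≡y x y∈⁅x⁆)) x∈p
  ... | inj₂ y∈xs  = fromList-⊆ xs⊆p y∈xs

  ∣fromList∣≡length : ∀ {n} {xs : List (Fin n)} → Unique xs → ∣ fromList xs ∣ ≡ length xs
  ∣fromList∣≡length {n} {xs} u =
    ≤-antisym (upper xs) (Unique∧All∈⇒length≤∣p∣ (fromList xs) u (All.tabulate ∈-fromList⁺))
    where
    upper : ∀ ys → ∣ fromList {n} ys ∣ ≤ length ys
    upper []       = ≤-reflexive (∣⊥∣≡0 n)
    upper (y ∷ ys) = ≤-trans (∣p∪q∣≤∣p∣+∣q∣ ⁅ y ⁆ _) (+-mono-≤ (≤-reflexive (∣⁅x⁆∣≡1 y)) (upper ys))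


module Supersets where

  open FallingFactorial
  open ListProperties
  open import Data.Nat
  open import Data.Nat.Properties
  open import Data.Nat.Combinatorics using (_C_; nCk+nC[k+1]≡[n+1]C[k+1])
  open import Data.Nat.Tactic.RingSolver using (solve-∀)
  open import Data.Bool using (Bool; true; false)
  import Data.Bool.Properties as Bool
  open import Data.Fin.Subset using (Subset; ∣_∣; _⊆_)
  open import Data.Fin.Subset.Properties using (∣p∣≤n; p⊆q⇒∣p∣≤∣q∣; drop-∷-⊆; _⊆?_)
  open import Data.Vec using (_∷_; [])
  open Data.Vec._[_]=_ using (here)
  open import Data.List using (List; []; _∷_; length; filter)
  open import Data.List.Relation.Unary.Any as Any using (Any)
  open import Data.List.Relation.Unary.All as All using (All; []; _∷_)
  import Data.List.Relation.Unary.All.Properties as All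
  open import Data.List.Relation.Unary.AllPairs using ([]; _∷_)
  open import Data.List.Relation.Unary.Unique.Propositional using (Unique)
  import Data.List.Relation.Unary.Unique.Propositional.Properties as Unique
  open import Data.Product using (_×_; _,_)
  import Data.Product as Product
  open import Relation.Nullary using (¬_; yes; no; contradiction)
  open import Relation.Unary.Properties using (∁?)
  open import Relation.Binary.PropositionalEquality

  tailsWith : ∀ {n} → Bool → List (Subset (suc n)) → List (Subset n)
  tailsWith b []            = []
  tailsWith b ((x ∷ s) ∷ L) with x Bool.≟ b
  ... | yes _ = s ∷ tailsWith b L
  ... | no  _ = tailsWith b L

  length-tailsWith : ∀ {n} (L : List (Subset (suc n))) →
                     length L ≡ length (tailsWith true L) + length (tailsWith false L)
  length-tailsWith []                = refl
  length-tailsWith ((true  ∷ s) ∷ L) = cong suc (length-tailsWith L)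
  length-tailsWith ((false ∷ s) ∷ L) = trans (cong suc (length-tailsWith L)) (sym (+-suc _ _))

  All-tailsWith : ∀ {n} {P : Subset (suc n) → Set} {b L} → All P L → All (λ s → P (b ∷ s)) (tailsWith b L)
  All-tailsWith {L = []} [] = []
  All-tailsWith {b = b} {L = (x ∷ s) ∷ L} (p ∷ ps) with x Bool.≟ b
  ... | yes refl = p ∷ All-tailsWith ps
  ... | no  _    = All-tailsWith ps

  Unique-tailsWith : ∀ {n} {b} {L : List (Subset (suc n))} → Unique L → Unique (tailsWith b L)
  Unique-tailsWith {L = []} [] = []
  Unique-tailsWith {b = b} {L = (x ∷ s) ∷ L} (s∉L ∷ u) with x Bool.≟ b
  ... | yes refl = All.map (λ ne eq → ne (cong (b ∷_) eq)) (All-tailsWith s∉L) ∷ Unique-tailsWith u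
  ... | no  _    = Unique-tailsWith u

  -- Induction on n, splitting L by membership of the first vertex; the halves give Pascal's rule.
  supersets-length : ∀ {n} (V : Subset n) r {L : List (Subset n)} → Unique L →
                     All (λ S → ∣ S ∣ ≡ ∣ V ∣ + r × V ⊆ S) L → length L ≤ (n ∸ ∣ V ∣) C r
  supersets-length []      zero    {[]}          _                   _ = z≤n
  supersets-length []      zero    {[] ∷ []}     _                   _ = s≤s z≤n
  supersets-length []      zero    {[] ∷ [] ∷ _} ((ne ∷ _) ∷ _)      _ = contradiction refl ne
  supersets-length []      (suc r) {[]}          _                   _ = z≤n
  supersets-length []      (suc r) {[] ∷ _}      _   ((() , _) ∷ _)
  supersets-length {suc n} (true ∷ V) r {L} u sizes = begin
    length L
      ≡⟨ length-tailsWith L ⟩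
    length (tailsWith true L) + length (tailsWith false L)
      ≡⟨ cong (length (tailsWith true L) +_) (All-⊥⇒length≡0 (λ (_ , V⊆S) → contradiction (V⊆S here) λ ())
                                                             (All-tailsWith sizes)) ⟩
    length (tailsWith true L) + 0
      ≡⟨ +-identityʳ _ ⟩
    length (tailsWith true L)
      ≤⟨ supersets-length V r (Unique-tailsWith u) (All.map (Product.map suc-injective drop-∷-⊆) (All-tailsWith sizes)) ⟩
    (n ∸ ∣ V ∣) C r ∎
    where open ≤-Reasoning
  supersets-length {suc n} (false ∷ V) zero {L} u sizes = begin
    length L
      ≡⟨ length-tailsWith L ⟩
    length (tailsWith true L) + length (tailsWith false L)
      ≡⟨ cong (_+ length (tailsWith false L)) (All-⊥⇒length≡0 too-big (All-tailsWith sizes)) ⟩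
    length (tailsWith false L)
      ≤⟨ supersets-length V zero (Unique-tailsWith u) (All.map (Product.map₂ drop-∷-⊆) (All-tailsWith sizes)) ⟩
    (suc n ∸ ∣ V ∣) C 0 ∎
    where
    open ≤-Reasoning
    too-big : ∀ {s} → ¬ (suc ∣ s ∣ ≡ ∣ V ∣ + 0 × (false ∷ V) ⊆ (true ∷ s))
    too-big {s} (e , V⊆S) = <⇒≱ (≤-reflexive (trans e (+-identityʳ ∣ V ∣))) (p⊆q⇒∣p∣≤∣q∣ (drop-∷-⊆ V⊆S))
  supersets-length {suc n} (false ∷ V) (suc r) {L} u sizes = begin
    length L
      ≡⟨ length-tailsWith L ⟩
    length (tailsWith true L) + length (tailsWith false L)
      ≤⟨ +-mono-≤ (supersets-length V r (Unique-tailsWith u) with-first)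
                  (supersets-length V (suc r) (Unique-tailsWith u) without-first) ⟩
    (n ∸ ∣ V ∣) C r + (n ∸ ∣ V ∣) C suc r
      ≡⟨ nCk+nC[k+1]≡[n+1]C[k+1] (n ∸ ∣ V ∣) r ⟩
    suc (n ∸ ∣ V ∣) C suc r
      ≡⟨ cong (_C suc r) (+-∸-assoc 1 (∣p∣≤n V)) ⟨
    (suc n ∸ ∣ V ∣) C suc r ∎
    where
    open ≤-Reasoning
    with-first : All (λ S → ∣ S ∣ ≡ ∣ V ∣ + r × V ⊆ S) (tailsWith true L)
    with-first = All.map (Product.map (λ e → suc-injective (trans e (+-suc _ _))) drop-∷-⊆) (All-tailsWith sizes)
    without-first : All (λ S → ∣ S ∣ ≡ ∣ V ∣ + suc r × V ⊆ S) (tailsWith false L)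
    without-first = All.map (Product.map₂ drop-∷-⊆) (All-tailsWith sizes)

  supersets-count : ∀ {n t} (V : Subset n) {L : List (Subset n)} → Unique L →
                    All (λ S → ∣ S ∣ ≡ t × V ⊆ S) L → length L * n ↓ ∣ V ∣ ≤ (n C t) * t ↓ ∣ V ∣
  supersets-count {n} {t} V {L} u sizes with ∣ V ∣ ≤? t
  ... | yes ∣V∣≤t = ≤[n∸k]C[t∸k]⇒*n↓k≤nCt*t↓k (∣p∣≤n V) ∣V∣≤t
                      (supersets-length V (t ∸ ∣ V ∣) u
                        (All.map (Product.map₁ (λ e → trans e (sym (m+[n∸m]≡n ∣V∣≤t)))) sizes))
  ... | no  ∣V∣≰t = ≤-trans (≤-reflexive (cong (_* n ↓ ∣ V ∣) (All-⊥⇒length≡0 too-big sizes))) z≤n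
    where
    too-big : ∀ {S} → ¬ (∣ S ∣ ≡ t × V ⊆ S)
    too-big (e , V⊆S) = ∣V∣≰t (subst (∣ V ∣ ≤_) e (p⊆q⇒∣p∣≤∣q∣ V⊆S))

  -- Of the factors t↓k/n↓k of the previous bound, those (t-m)/(n-m) with m ≥ i are at most t/n.
  supersets-bound : ∀ {n t i j} (V : Subset n) {L : List (Subset n)} → t ≤ n → ∣ V ∣ ≡ i + j →
                    Unique L → All (λ S → ∣ S ∣ ≡ t × V ⊆ S) L →
                    length L * (n ^ j * n ↓ i) ≤ (n C t) * (t ^ j * t ↓ i)
  supersets-bound {n} {t} {i} {j} V {L} t≤n ∣V∣≡i+j u sizes =
    *-cancelʳ-≤ _ _ ((n ∸ i) ↓ j) {{↓-nonZero j≤n∸i}} (begin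
    length L * (n ^ j * n ↓ i) * (n ∸ i) ↓ j
      ≡⟨ regroup₁ (length L) (n ^ j) (n ↓ i) ((n ∸ i) ↓ j) ⟩
    n ^ j * (length L * (n ↓ i * (n ∸ i) ↓ j))
      ≡⟨ cong (λ m → n ^ j * (length L * m)) (↓-+ n i j) ⟨
    n ^ j * (length L * n ↓ (i + j))
      ≤⟨ *-monoʳ-≤ (n ^ j) count ⟩
    n ^ j * ((n C t) * t ↓ (i + j))
      ≡⟨ trans (cong (λ m → n ^ j * ((n C t) * m)) (↓-+ t i j)) (regroup₂ (n ^ j) (n C t) (t ↓ i) ((t ∸ i) ↓ j)) ⟩
    (n C t) * t ↓ i * (n ^ j * (t ∸ i) ↓ j)
      ≤⟨ *-monoʳ-≤ ((n C t) * t ↓ i) (m^k*[n∸o]↓k≤n^k*[m∸o]↓k t≤n j i) ⟩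
    (n C t) * t ↓ i * (t ^ j * (n ∸ i) ↓ j)
      ≡⟨ regroup₃ (n C t) (t ↓ i) (t ^ j) ((n ∸ i) ↓ j) ⟩
    (n C t) * (t ^ j * t ↓ i) * (n ∸ i) ↓ j ∎)
    where
    open ≤-Reasoning
    j≤n∸i : j ≤ n ∸ i
    j≤n∸i = subst (_≤ n ∸ i) (m+n∸m≡n i j) (∸-monoˡ-≤ i (subst (_≤ n) ∣V∣≡i+j (∣p∣≤n V)))
    count : length L * n ↓ (i + j) ≤ (n C t) * t ↓ (i + j)
    count = subst (λ k → length L * n ↓ k ≤ (n C t) * t ↓ k) ∣V∣≡i+j (supersets-count V u sizes)
    regroup₁ : ∀ ℓ a b c → ℓ * (a * b) * c ≡ a * (ℓ * (b * c))
    regroup₁ = solve-∀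
    regroup₂ : ∀ a b c d → a * (b * (c * d)) ≡ b * c * (a * d)
    regroup₂ = solve-∀
    regroup₃ : ∀ a b c d → a * b * (c * d) ≡ a * (c * b) * d
    regroup₃ = solve-∀

  covered-bound : ∀ {n t i j} {W L : List (Subset n)} → t ≤ n → All (λ V → ∣ V ∣ ≡ i + j) W →
                  Unique L → All (λ S → ∣ S ∣ ≡ t) L → All (λ S → Any (_⊆ S) W) L →
                  length L * (n ^ j * n ↓ i) ≤ length W * ((n C t) * (t ^ j * t ↓ i))
  covered-bound {W = []} _ _ _ _ covered = ≤-reflexive (cong (_* _) (All-⊥⇒length≡0 (λ ()) covered))
  covered-bound {n} {t} {i} {j} {V ∷ W} {L} t≤n (∣V∣≡i+j ∷ sizesW) u sizes covered = begin
    length L * F                   ≡⟨ cong (_* F) (length-filter+filter-∁ (V ⊆?_) L) ⟨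
    (length L₁ + length L₂) * F    ≡⟨ *-distribʳ-+ F (length L₁) (length L₂) ⟩
    length L₁ * F + length L₂ * F  ≤⟨ +-mono-≤ bound₁ bound₂ ⟩
    G + length W * G               ∎
    where
    open ≤-Reasoning
    F G : ℕ
    F = n ^ j * n ↓ i
    G = (n C t) * (t ^ j * t ↓ i)
    L₁ L₂ : List (Subset n)
    L₁ = filter (V ⊆?_) L
    L₂ = filter (∁? (V ⊆?_)) L
    bound₁ : length L₁ * F ≤ G
    bound₁ = supersets-bound {i = i} {j} V t≤n ∣V∣≡i+j (Unique.filter⁺ (V ⊆?_) u)
               (All.zip (All.filter⁺ (V ⊆?_) sizes , All.all-filter (V ⊆?_) L))
    bound₂ : length L₂ * F ≤ length W * G
    bound₂ = covered-bound {i = i} {j} t≤n sizesW (Unique.filter⁺ (∁? (V ⊆?_)) u)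
               (All.filter⁺ (∁? (V ⊆?_)) sizes)
               (All.zipWith (λ (cov , V⊈S) → Any.tail V⊈S cov)
                 (All.filter⁺ (∁? (V ⊆?_)) covered , All.all-filter (∁? (V ⊆?_)) L))


module Witnesses where

  open import Defs
  open FallingFactorial
  open ListProperties
  open Subsets
  open import Data.Nat using (ℕ; zero; suc; _+_; _*_; _≤_; z≤n; s≤s)
  import Data.Nat.Properties as ℕ
  open import Data.Nat.Properties using (*-monoʳ-≤; +-identityʳ; *-assoc)
  open import Data.Nat.Tactic.RingSolver using (solve-∀)
  open import Data.Fin using (Fin; zero; suc; _<_)
  open import Data.Fin.Properties using (_≟_; <-cmp; <⇒≢; <-trans)
  open import Data.Fin.Subset using (Subset; _∈_; _⊆_; ∣_∣)
  open import Data.Fin.Subset.Properties using (_⊆?_)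
  open import Data.List using (List; []; _∷_; length; map; filter; concatMap; allFin; cartesianProductWith; _++_)
  open import Data.List.Properties using (length-++; length-map; length-tabulate)
  open import Data.List.Membership.Propositional using (lose) renaming (_∈_ to _∈ₗ_)
  open import Data.List.Membership.Propositional.Properties
    using (∈-map⁺; ∈-++⁺ˡ; ∈-++⁺ʳ; ∈-allFin; ∈-filter⁺; ∈-cartesianProductWith⁺)
  open import Data.List.Relation.Unary.Any as Any using (Any)
  open import Data.List.Relation.Unary.All as All using (All; []; _∷_)
  import Data.List.Relation.Unary.All.Properties as All
  open import Data.List.Relation.Unary.AllPairs using ([]; _∷_)
  open import Data.List.Relation.Unary.Unique.Propositional using (Unique)
  open import Data.List.Relation.Binary.Sublist.Propositional using () renaming (⊆-refl to ⊆ₗ-refl)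
  import Data.List.Relation.Binary.Sublist.Propositional.Properties as Sublist
  open import Data.List.Extrema.Nat using (max; xs≤max; argmax-all)
  open import Data.Product using (_×_; _,_; swap)
  import Data.Product as Product
  open import Data.Sum using (_⊎_; inj₁; inj₂)
  open import Data.Empty using (⊥-elim)
  open import Relation.Nullary using (¬_; yes; no; contradiction)
  open import Relation.Nullary.Decidable using (_×-dec_; ¬?)
  open import Relation.Unary using (Decidable)
  open import Relation.Binary.PropositionalEquality
  open import Relation.Binary.Definitions using (tri<; tri≈; tri>)

  length-vertices : ∀ n → length (vertices n) ≡ n
  length-vertices n = length-tabulate {n = n} (λ x → x)

  increasingPairs : ∀ n → List (Fin n × Fin n)
  increasingPairs zero    = []
  increasingPairs (suc n) = map (λ b → zero , suc b) (allFin n) ++ map (Product.map suc suc) (increasingPairs n)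

  ∈-increasingPairs : ∀ {n} {a b : Fin n} → a < b → (a , b) ∈ₗ increasingPairs n
  ∈-increasingPairs {suc n} {zero}  {suc b} _         = ∈-++⁺ˡ (∈-map⁺ (λ b → zero , suc b) (∈-allFin b))
  ∈-increasingPairs {suc n} {suc a} {suc b} (s≤s a<b) = ∈-++⁺ʳ _ (∈-map⁺ (Product.map suc suc) (∈-increasingPairs a<b))

  2*length-increasingPairs : ∀ n → 2 * length (increasingPairs n) ≡ n ↓ 2
  2*length-increasingPairs zero    = refl
  2*length-increasingPairs (suc n) = begin
    2 * length (increasingPairs (suc n))
      ≡⟨ cong (2 *_) (length-++ (map (λ b → zero {n} , suc b) (allFin n))) ⟩
    2 * (length (map (λ b → zero {n} , suc b) (allFin n)) + length (map (Product.map suc suc) (increasingPairs n)))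
      ≡⟨ cong₂ (λ x y → 2 * (x + y)) (trans (length-map _ (allFin n)) (length-vertices n)) (length-map _ (increasingPairs n)) ⟩
    2 * (n + length (increasingPairs n))          ≡⟨ ℕ.*-distribˡ-+ 2 n _ ⟩
    2 * n + 2 * length (increasingPairs n)        ≡⟨ cong (2 * n +_) (2*length-increasingPairs n) ⟩
    2 * n + n ↓ 2                                 ≡⟨ step n ⟩
    suc n ↓ 2                                     ∎
    where
    open ≡-Reasoning
    step : ∀ n → 2 * n + n ↓ 2 ≡ suc n ↓ 2
    step zero    = refl
    step (suc m) = identity m
      where
      identity : ∀ m → 2 * suc m + suc m * (m * 1) ≡ suc (suc m) * (suc m * 1)
      identity = solve-∀

  distinctPairs : ∀ n → List (Fin n × Fin n)
  distinctPairs n = increasingPairs n ++ map swap (increasingPairs n)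

  ∈-distinctPairs : ∀ {n} {a b : Fin n} → a ≢ b → (a , b) ∈ₗ distinctPairs n
  ∈-distinctPairs {n} {a} {b} a≢b with <-cmp a b
  ... | tri< a<b _ _ = ∈-++⁺ˡ (∈-increasingPairs a<b)
  ... | tri≈ _ a≡b _ = contradiction a≡b a≢b
  ... | tri> _ _ b<a = ∈-++⁺ʳ (increasingPairs n) (∈-map⁺ swap (∈-increasingPairs b<a))

  length-distinctPairs : ∀ n → length (distinctPairs n) ≡ n ↓ 2
  length-distinctPairs n = begin
    length (increasingPairs n ++ map swap (increasingPairs n))
      ≡⟨ length-++ (increasingPairs n) ⟩
    ℓ + length (map swap (increasingPairs n))
      ≡⟨ cong (ℓ +_) (trans (length-map swap (increasingPairs n)) (sym (+-identityʳ ℓ))) ⟩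
    2 * ℓ
      ≡⟨ 2*length-increasingPairs n ⟩
    n ↓ 2 ∎
    where
    open ≡-Reasoning
    ℓ : ℕ
    ℓ = length (increasingPairs n)

  module _ {n : ℕ} (c : EdgeColoring n) where

    open import Data.List.Relation.Unary.Unique.DecPropositional (_≟_ {n}) using (unique?)

    SameColourMatching : Fin n → Fin n → Fin n → Fin n → Set
    SameColourMatching a b a' b' = col c a' b' ≡ col c a b × Unique (a ∷ b ∷ a' ∷ b' ∷ [])

    SameColourCherry : Fin n → Fin n → Fin n → Set
    SameColourCherry s b w = col c s w ≡ col c s b × Unique (s ∷ b ∷ w ∷ [])

    sameColourMatching? : ∀ a b a' → Decidable (SameColourMatching a b a')
    sameColourMatching? a b a' b' = col c a' b' ℕ.≟ col c a b ×-dec unique? (a ∷ b ∷ a' ∷ b' ∷ [])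

    sameColourCherry? : ∀ s b → Decidable (SameColourCherry s b)
    sameColourCherry? s b w = col c s w ℕ.≟ col c s b ×-dec unique? (s ∷ b ∷ w ∷ [])

    matchingsThrough : Fin n × Fin n → Fin n → List (Subset n)
    matchingsThrough (a , b) a' =
      map (λ b' → fromList (a ∷ b ∷ a' ∷ b' ∷ [])) (filter (sameColourMatching? a b a') (vertices n))

    matchingsAt : Fin n × Fin n → List (Subset n)
    matchingsAt p = concatMap (matchingsThrough p) (vertices n)

    cherriesAt : Fin n × Fin n → List (Subset n)
    cherriesAt (s , b) = map (λ w → fromList (s ∷ b ∷ w ∷ [])) (filter (sameColourCherry? s b) (vertices n))

    matchingWitnesses : List (Subset n)
    matchingWitnesses = concatMap matchingsAt (increasingPairs n)

    cherryWitnesses : List (Subset n)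
    cherryWitnesses = concatMap cherriesAt (distinctPairs n)

    -- Colours are arbitrary naturals, so the maximum is taken over the colours that occur on edges.
    maxDegree : ℕ
    maxDegree = max 0 (cartesianProductWith (deg c) (vertices n) edgeColours)
      where
      edgeColours : List ℕ
      edgeColours = cartesianProductWith (col c) (vertices n) (vertices n)

    deg≤maxDegree : ∀ x y z → deg c x (col c y z) ≤ maxDegree
    deg≤maxDegree x y z = All.lookup (xs≤max 0 _)
      (∈-cartesianProductWith⁺ (deg c) (∈-allFin x) (∈-cartesianProductWith⁺ (col c) (∈-allFin y) (∈-allFin z)))

    maxDegree-bounded : ∀ {P : ℕ → Set} → P 0 → (∀ x i → P (deg c x i)) → P maxDegree
    maxDegree-bounded {P} P0 Pdeg = argmax-all (λ d → d) {P = P} P0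
      (All.cartesianProductWith⁺ (setoid (Fin n)) (setoid ℕ) (deg c) (vertices n) _ (λ {x} {i} _ _ → Pdeg x i))

    length-filter≤deg : ∀ {P : Fin n → Set} (P? : Decidable P) x i → (∀ {y} → P y → ¬ y ≡ x × col c x y ≡ i) →
                        length (filter P? (vertices n)) ≤ deg c x i
    length-filter≤deg P? x i P⇒ = Sublist.length-mono-≤
      (Sublist.filter⁺ P? (λ y → ¬? (y ≟ x) ×-dec (col c x y ℕ.≟ i)) (λ { refl → P⇒ }) (⊆ₗ-refl {x = vertices n}))

    length-matchingsThrough : ∀ a b a' → length (matchingsThrough (a , b) a') ≤ maxDegree
    length-matchingsThrough a b a' = begin
      length (matchingsThrough (a , b) a')
        ≡⟨ length-map _ (filter (sameColourMatching? a b a') (vertices n)) ⟩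
      length (filter (sameColourMatching? a b a') (vertices n))
        ≤⟨ length-filter≤deg (sameColourMatching? a b a') a' (col c a b) same-colour ⟩
      deg c a' (col c a b)
        ≤⟨ deg≤maxDegree a' a b ⟩
      maxDegree ∎
      where
      open ℕ.≤-Reasoning
      same-colour : ∀ {b'} → SameColourMatching a b a' b' → ¬ b' ≡ a' × col c a' b' ≡ col c a b
      same-colour (same , _ ∷ _ ∷ (a'≢b' ∷ []) ∷ _) = ≢-sym a'≢b' , same

    length-cherriesAt : ∀ s b → length (cherriesAt (s , b)) ≤ maxDegree
    length-cherriesAt s b = begin
      length (cherriesAt (s , b))
        ≡⟨ length-map _ (filter (sameColourCherry? s b) (vertices n)) ⟩
      length (filter (sameColourCherry? s b) (vertices n))
        ≤⟨ length-filter≤deg (sameColourCherry? s b) s (col c s b) same-colour ⟩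
      deg c s (col c s b)
        ≤⟨ deg≤maxDegree s s b ⟩
      maxDegree ∎
      where
      open ℕ.≤-Reasoning
      same-colour : ∀ {w} → SameColourCherry s b w → ¬ w ≡ s × col c s w ≡ col c s b
      same-colour (same , (_ ∷ s≢w ∷ []) ∷ _) = ≢-sym s≢w , same

    2*length-matchingWitnesses : 2 * length matchingWitnesses ≤ n ↓ 2 * (n * maxDegree)
    2*length-matchingWitnesses = begin
      2 * length matchingWitnesses
        ≤⟨ *-monoʳ-≤ 2 (length-concatMap-≤ matchingsAt (increasingPairs n) length-matchingsAt) ⟩
      2 * (length (increasingPairs n) * (n * maxDegree))
        ≡⟨ sym (*-assoc 2 (length (increasingPairs n)) (n * maxDegree)) ⟩
      2 * length (increasingPairs n) * (n * maxDegree)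
        ≡⟨ cong (_* (n * maxDegree)) (2*length-increasingPairs n) ⟩
      n ↓ 2 * (n * maxDegree) ∎
      where
      open ℕ.≤-Reasoning
      length-matchingsAt : ∀ p → length (matchingsAt p) ≤ n * maxDegree
      length-matchingsAt (a , b) = subst (λ m → length (matchingsAt (a , b)) ≤ m * maxDegree) (length-vertices n)
        (length-concatMap-≤ (matchingsThrough (a , b)) (vertices n) (length-matchingsThrough a b))

    length-cherryWitnesses : length cherryWitnesses ≤ n ↓ 2 * maxDegree
    length-cherryWitnesses = subst (λ m → length cherryWitnesses ≤ m * maxDegree) (length-distinctPairs n)
      (length-concatMap-≤ cherriesAt (distinctPairs n) λ (s , b) → length-cherriesAt s b)

    matchingWitnesses-size : All (λ V → ∣ V ∣ ≡ 2 + 2) matchingWitnesses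
    matchingWitnesses-size =
      All-concatMap⁺ matchingsAt (increasingPairs n) λ (a , b) →
      All-concatMap⁺ (matchingsThrough (a , b)) (vertices n) λ a' →
      All.map⁺ (All.map (λ (_ , u) → ∣fromList∣≡length u) (All.all-filter (sameColourMatching? a b a') (vertices n)))

    cherryWitnesses-size : All (λ V → ∣ V ∣ ≡ 2 + 1) cherryWitnesses
    cherryWitnesses-size =
      All-concatMap⁺ cherriesAt (distinctPairs n) λ (s , b) →
      All.map⁺ (All.map (λ (_ , u) → ∣fromList∣≡length u) (All.all-filter (sameColourCherry? s b) (vertices n)))

    matching⊆ : ∀ {S a b a' b'} → a < b → SameColourMatching a b a' b' → All (_∈ S) (a ∷ b ∷ a' ∷ b' ∷ []) →
                Any (_⊆ S) matchingWitnesses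
    matching⊆ {a = a} {b} {a'} {b'} a<b m ⊆S = lose
      (∈-concatMap⁺ {f = matchingsAt}
        (∈-concatMap⁺ {f = matchingsThrough (a , b)}
          (∈-map⁺ _ (∈-filter⁺ (sameColourMatching? a b a') (∈-allFin b') m))
          (∈-allFin a'))
        (∈-increasingPairs a<b))
      (fromList-⊆ ⊆S)

    cherry⊆ : ∀ {S s b w} → SameColourCherry s b w → All (_∈ S) (s ∷ b ∷ w ∷ []) → Any (_⊆ S) cherryWitnesses
    cherry⊆ {s = s} {b} {w} ch@(_ , (s≢b ∷ _) ∷ _) ⊆S = lose
      (∈-concatMap⁺ {f = cherriesAt}
        (∈-map⁺ _ (∈-filter⁺ (sameColourCherry? s b) (∈-allFin w) ch))
        (∈-distinctPairs s≢b))
      (fromList-⊆ ⊆S)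

    rainbow-without-witness : ∀ S → ¬ Any (_⊆ S) matchingWitnesses → ¬ Any (_⊆ S) cherryWitnesses →
                              Rainbow c S
    rainbow-without-witness S no-matching no-cherry a b a' b' (a∈S , b∈S , a<b) (a'∈S , b'∈S , a'<b') same
      with a ≟ a' | b ≟ b'
    ... | yes refl | yes refl = refl , refl
    ... | yes refl | no b≢b' = ⊥-elim (no-cherry (cherry⊆
            (sym same , (<⇒≢ a<b ∷ <⇒≢ a'<b' ∷ []) ∷ (b≢b' ∷ []) ∷ [] ∷ [])
            (a∈S ∷ b∈S ∷ b'∈S ∷ [])))
    ... | no a≢a' | yes refl = ⊥-elim (no-cherry (cherry⊆
            (trans (symm c b a') (trans (sym same) (symm c a b)) ,
             (≢-sym (<⇒≢ a<b) ∷ ≢-sym (<⇒≢ a'<b') ∷ []) ∷ (a≢a' ∷ []) ∷ [] ∷ [])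
            (b∈S ∷ a∈S ∷ a'∈S ∷ [])))
    ... | no a≢a' | no b≢b' with a ≟ b' | b ≟ a'
    ...   | yes refl | _ = ⊥-elim (no-cherry (cherry⊆
            (trans (symm c a a') (sym same) ,
             (<⇒≢ a<b ∷ ≢-sym (<⇒≢ a'<b') ∷ []) ∷ (≢-sym (<⇒≢ (<-trans a'<b' a<b)) ∷ []) ∷ [] ∷ [])
            (a∈S ∷ b∈S ∷ a'∈S ∷ [])))
    ...   | no _ | yes refl = ⊥-elim (no-cherry (cherry⊆
            (trans (sym same) (symm c a b) ,
             (≢-sym (<⇒≢ a<b) ∷ <⇒≢ a'<b' ∷ []) ∷ (<⇒≢ (<-trans a<b a'<b') ∷ []) ∷ [] ∷ [])
            (b∈S ∷ a∈S ∷ b'∈S ∷ [])))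
    ...   | no a≢b' | no b≢a' = ⊥-elim (no-matching (matching⊆ a<b
            (sym same , (<⇒≢ a<b ∷ a≢a' ∷ a≢b' ∷ []) ∷ (b≢a' ∷ b≢b' ∷ []) ∷ (<⇒≢ a'<b' ∷ []) ∷ [] ∷ [])
            (a∈S ∷ b∈S ∷ a'∈S ∷ b'∈S ∷ [])))

    nonRainbow⇒witness : ∀ {S} → ¬ Rainbow c S → Any (_⊆ S) matchingWitnesses ⊎ Any (_⊆ S) cherryWitnesses
    nonRainbow⇒witness {S} ¬rainbow
      with Any.any? (_⊆? S) matchingWitnesses | Any.any? (_⊆? S) cherryWitnesses
    ... | yes m  | _      = inj₁ m
    ... | no _   | yes ch = inj₂ ch
    ... | no ¬m  | no ¬ch = contradiction (rainbow-without-witness S ¬m ¬ch) ¬rainbow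

  nonRainbow⇒2≤n : ∀ {n} (c : EdgeColoring n) {S} → ¬ Rainbow c S → 2 ≤ n
  nonRainbow⇒2≤n {zero}        _ ¬rainbow = contradiction (λ ()) ¬rainbow
  nonRainbow⇒2≤n {suc zero}    _ ¬rainbow = contradiction (λ { zero zero _ _ (_ , _ , ()) }) ¬rainbow
  nonRainbow⇒2≤n {suc (suc n)} _ _        = s≤s (s≤s z≤n)


module Counting where

  open import Defs
  open FallingFactorial
  open ListProperties
  open Supersets
  open Witnesses
  open import Data.Nat as ℕ using (ℕ; zero; suc; _+_; _*_; _^_; _≤_; z≤n; s≤s; NonZero)
  import Data.Nat.Properties as ℕ
  open import Data.Nat.Properties using (*-cancelʳ-≤; m*n≢0; +-mono-≤; *-monoʳ-≤; *-monoˡ-≤; m≤m+n)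
  open import Data.Nat.Tactic.RingSolver using (solve-∀)
  open import Data.Nat.Combinatorics using (_C_)
  open import Data.Fin.Subset using (Subset; ∣_∣; _⊆_)
  open import Data.Fin.Subset.Properties using (∣p∣≤n; _⊆?_)
  open import Data.List using (List; []; _∷_; length; filter)
  open import Data.List.Relation.Unary.Any as Any using (Any)
  open import Data.List.Relation.Unary.All as All using (All; _∷_)
  import Data.List.Relation.Unary.All.Properties as All
  open import Data.List.Relation.Unary.Unique.Propositional using (Unique)
  import Data.List.Relation.Unary.Unique.Propositional.Properties as Unique
  open import Data.Product using (_×_; _,_; proj₁; proj₂)
  open import Data.Sum using (fromInj₂)
  open import Function using (_∘_)
  open import Relation.Nullary using (¬_; contradiction)
  open import Relation.Unary using (Decidable)
  open import Relation.Unary.Properties using (∁?)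
  open import Relation.Binary.PropositionalEquality

  -- 5t⁴ - 4t³(t-1) - 8t²(t-1) = t²((t-2)² + 4).
  counting-polynomial : ∀ t → 4 * (t ^ 2 * t ↓ 2) + 8 * (t ^ 1 * t ↓ 2) ≤ 5 * t ^ 4
  counting-polynomial zero          = z≤n
  counting-polynomial (suc zero)    = z≤n
  counting-polynomial (suc (suc u)) = begin
    4 * (t ^ 2 * t ↓ 2) + 8 * (t ^ 1 * t ↓ 2)                       ≤⟨ m≤m+n _ (t ^ 2 * (u * u + 4)) ⟩
    4 * (t ^ 2 * t ↓ 2) + 8 * (t ^ 1 * t ↓ 2) + t ^ 2 * (u * u + 4) ≡⟨ identity u ⟩
    5 * t ^ 4                                                   ∎
    where
    open ℕ.≤-Reasoning
    t : ℕ
    t = 2 + u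
    identity : ∀ u → let t = 2 + u in 4 * (t * (t * 1) * (t * ((1 + u) * 1))) + 8 * (t * 1 * (t * ((1 + u) * 1)))
                                       + t * (t * 1) * (u * u + 4) ≡ 5 * (t * (t * (t * (t * 1))))
    identity = solve-∀

  counting-inequality : ∀ {n t d c ℓ₁ ℓ₂ w₁ w₂} → 2 ≤ n →
    ℓ₁ * (n ^ 2 * n ↓ 2) ≤ w₁ * (c * (t ^ 2 * t ↓ 2)) → 2 * w₁ ≤ n ↓ 2 * (n * d) →
    ℓ₂ * (n ^ 1 * n ↓ 2) ≤ w₂ * (c * (t ^ 1 * t ↓ 2)) → w₂ ≤ n ↓ 2 * d →
    8 * n * (ℓ₁ + ℓ₂) ≤ 5 * d * t ^ 4 * c
  counting-inequality {n} {t} {d} {c} {ℓ₁} {ℓ₂} {w₁} {w₂} 2≤n h₁ hw₁ h₂ hw₂ =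
    *-cancelʳ-≤ _ _ (n * n ↓ 2) {{m*n≢0 n (n ↓ 2) {{n≢0}} {{↓-nonZero 2≤n}}}} (begin
      8 * n * (ℓ₁ + ℓ₂) * (n * P)
        ≡⟨ e₁ n P ℓ₁ ℓ₂ ⟩
      4 * (2 * (ℓ₁ * (n ^ 2 * P))) + 8 * n * (ℓ₂ * (n ^ 1 * P))
        ≤⟨ +-mono-≤ (*-monoʳ-≤ 4 (*-monoʳ-≤ 2 h₁)) (*-monoʳ-≤ (8 * n) h₂) ⟩
      4 * (2 * (w₁ * (c * A))) + 8 * n * (w₂ * (c * B))
        ≡⟨ cong (λ x → 4 * x + 8 * n * (w₂ * (c * B))) (sym (ℕ.*-assoc 2 w₁ (c * A))) ⟩
      4 * (2 * w₁ * (c * A)) + 8 * n * (w₂ * (c * B))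
        ≤⟨ +-mono-≤ (*-monoʳ-≤ 4 (*-monoˡ-≤ (c * A) hw₁)) (*-monoʳ-≤ (8 * n) (*-monoˡ-≤ (c * B) hw₂)) ⟩
      4 * (P * (n * d) * (c * A)) + 8 * n * (P * d * (c * B))
        ≡⟨ e₂ n P d c A B ⟩
      d * c * (4 * A + 8 * B) * (n * P)
        ≤⟨ *-monoˡ-≤ (n * P) (*-monoʳ-≤ (d * c) (counting-polynomial t)) ⟩
      d * c * (5 * t ^ 4) * (n * P)
        ≡⟨ cong (_* (n * P)) (e₃ d c (t ^ 4)) ⟩
      5 * d * t ^ 4 * c * (n * P) ∎)
    where
    open ℕ.≤-Reasoning
    P A B : ℕ
    P = n ↓ 2
    A = t ^ 2 * t ↓ 2
    B = t ^ 1 * t ↓ 2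
    n≢0 : NonZero n
    n≢0 = ℕ.>-nonZero (ℕ.<-≤-trans (s≤s z≤n) 2≤n)
    e₁ : ∀ n P ℓ₁ ℓ₂ → 8 * n * (ℓ₁ + ℓ₂) * (n * P) ≡ 4 * (2 * (ℓ₁ * (n * (n * 1) * P))) + 8 * n * (ℓ₂ * (n * 1 * P))
    e₁ = solve-∀
    e₂ : ∀ n P d c A B → 4 * (P * (n * d) * (c * A)) + 8 * n * (P * d * (c * B)) ≡ d * c * (4 * A + 8 * B) * (n * P)
    e₂ = solve-∀
    e₃ : ∀ d c x → d * c * (5 * x) ≡ 5 * d * x * c
    e₃ = solve-∀

  nonRainbow-count : ∀ {n} (c : EdgeColoring n) t (L : List (Subset n)) → Unique L →
                     All (λ S → IsKt t S × ¬ Rainbow c S) L →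
                     8 * n * length L ≤ 5 * maxDegree c * t ^ 4 * (n C t)
  nonRainbow-count {n} c t []          _ _ = ℕ.≤-trans (ℕ.≤-reflexive (ℕ.*-zeroʳ (8 * n))) z≤n
  nonRainbow-count {n} c t L@(S ∷ _) u hyp@((∣S∣≡t , S-nonRainbow) ∷ _) =
    subst (λ ℓ → 8 * n * ℓ ≤ 5 * maxDegree c * t ^ 4 * (n C t)) (length-filter+filter-∁ hasMatching? L)
      (counting-inequality {n} {t} {maxDegree c} {n C t} {length L₁} {length L₂}
                           {length (matchingWitnesses c)} {length (cherryWitnesses c)} (nonRainbow⇒2≤n c S-nonRainbow)
         matchings-bound (2*length-matchingWitnesses c) cherries-bound (length-cherryWitnesses c))
    where
    hasMatching? : Decidable (λ S → Any (_⊆ S) (matchingWitnesses c))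
    hasMatching? S = Any.any? (_⊆? S) (matchingWitnesses c)
    L₁ L₂ : List (Subset n)
    L₁ = filter hasMatching? L
    L₂ = filter (∁? hasMatching?) L
    t≤n : t ≤ n
    t≤n = subst (_≤ n) ∣S∣≡t (∣p∣≤n S)
    sizes : All (λ S → ∣ S ∣ ≡ t) L
    sizes = All.map proj₁ hyp
    L₂-cherries : All (λ S → Any (_⊆ S) (cherryWitnesses c)) L₂
    L₂-cherries = All.zipWith (λ (witness , no-matching) → fromInj₂ (λ m → contradiction m no-matching) witness)
                    (All.filter⁺ (∁? hasMatching?) (All.map (nonRainbow⇒witness c ∘ proj₂) hyp) ,
                     All.all-filter (∁? hasMatching?) L)
    matchings-bound : length L₁ * (n ^ 2 * n ↓ 2) ≤ length (matchingWitnesses c) * ((n C t) * (t ^ 2 * t ↓ 2))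
    matchings-bound = covered-bound {i = 2} {2} t≤n (matchingWitnesses-size c) (Unique.filter⁺ hasMatching? u)
                        (All.filter⁺ hasMatching? sizes) (All.all-filter hasMatching? L)
    cherries-bound : length L₂ * (n ^ 1 * n ↓ 2) ≤ length (cherryWitnesses c) * ((n C t) * (t ^ 1 * t ↓ 2))
    cherries-bound = covered-bound {i = 2} {1} t≤n (cherryWitnesses-size c) (Unique.filter⁺ (∁? hasMatching?) u)
                       (All.filter⁺ (∁? hasMatching?) sizes) L₂-cherries

open import Defs
open import Data.Nat using (ℕ; _^_; suc; z≤n)
open import Data.Nat.Combinatorics using (_C_)
open import Data.Fin using (Fin)
open import Data.Fin.Subset using (Subset)
open import Data.List using (List; length)
open import Data.List.Relation.Unary.All using (All)
open import Data.List.Relation.Unary.Unique.Propositional using (Unique)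
open import Data.Integer using (+_)
open import Data.Rational using (ℚ; _≤_; _<_; _*_; _/_; 0ℚ)
open import Relation.Nullary using (¬_)
open import Data.Product using (_×_)

import Data.Nat as ℕ
import Data.Integer as ℤ
import Data.Integer.Properties as ℤ
open import Data.Rational using (mkℚ; *≤*; Positive; NonNegative)
import Data.Rational.Properties as ℚ
import Data.Rational.Unnormalised as ℚᵘ
import Data.Rational.Unnormalised.Properties as ℚᵘ
open import Data.Nat.Coprimality using (1-coprimeTo) renaming (sym to coprime-sym)
open import Data.Rational.Solver using (module +-*-Solver)
open import Data.Fin using (zero)
open import Relation.Binary.PropositionalEquality
open Witnesses using (maxDegree; maxDegree-bounded)
open Counting using (nonRainbow-count)

ℕtoℚ≡mkℚ : ∀ k → ℕtoℚ k ≡ mkℚ (+ k) 0 (coprime-sym (1-coprimeTo k))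
ℕtoℚ≡mkℚ k = ℚ.normalize-coprime (coprime-sym (1-coprimeTo k))

ℕtoℚ-* : ∀ a b → ℕtoℚ (a ℕ.* b) ≡ ℕtoℚ a * ℕtoℚ b
ℕtoℚ-* a b rewrite ℕtoℚ≡mkℚ (a ℕ.* b) | ℕtoℚ≡mkℚ a | ℕtoℚ≡mkℚ b = ℚ.toℚᵘ-injective
  (ℚᵘ.≃-trans (ℚᵘ.*≡* (cong (ℤ._* + 1) (ℤ.pos-* a b)))
              (ℚᵘ.≃-sym (ℚ.toℚᵘ-homo-* (mkℚ (+ a) 0 (coprime-sym (1-coprimeTo a)))
                                                (mkℚ (+ b) 0 (coprime-sym (1-coprimeTo b))))))

ℕtoℚ-mono-≤ : ∀ {a b} → a ℕ.≤ b → ℕtoℚ a ≤ ℕtoℚ b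
ℕtoℚ-mono-≤ {a} {b} a≤b rewrite ℕtoℚ≡mkℚ a | ℕtoℚ≡mkℚ b = *≤* (ℤ.*-monoʳ-≤-nonNeg (+ 1) (ℤ.+≤+ a≤b))

ℕtoℚ-nonNeg : ∀ k → NonNegative (ℕtoℚ k)
ℕtoℚ-nonNeg k = ℚ.normalize-nonNeg k 1

ℕtoℚ-pos : ∀ k .{{_ : ℕ.NonZero k}} → Positive (ℕtoℚ k)
ℕtoℚ-pos k = ℚ.normalize-pos k 1

scale-to-ℚ : ∀ {δ n ℓ d T C} → 8 ℕ.* suc n ℕ.* ℓ ℕ.≤ 5 ℕ.* d ℕ.* T ℕ.* C → ℕtoℚ d ≤ δ * ℕtoℚ (suc n) →
             ℕtoℚ ℓ ≤ (+ 5 / 8) * δ * ℕtoℚ T * ℕtoℚ C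
scale-to-ℚ {δ} {n} {ℓ} {d} {T} {C} count d≤δn =
  ℚ.*-cancelˡ-≤-pos (ℕtoℚ (8 ℕ.* suc n)) {{ℕtoℚ-pos (8 ℕ.* suc n)}} (begin
  ℕtoℚ (8 ℕ.* suc n) * ℕtoℚ ℓ
    ≡⟨ ℕtoℚ-* (8 ℕ.* suc n) ℓ ⟨
  ℕtoℚ (8 ℕ.* suc n ℕ.* ℓ)
    ≤⟨ ℕtoℚ-mono-≤ count ⟩
  ℕtoℚ (5 ℕ.* d ℕ.* T ℕ.* C)
    ≡⟨ ℕtoℚ-* (5 ℕ.* d ℕ.* T) C ⟩
  ℕtoℚ (5 ℕ.* d ℕ.* T) * ℕtoℚ C
    ≡⟨ cong (_* ℕtoℚ C) (trans (ℕtoℚ-* (5 ℕ.* d) T) (cong (_* ℕtoℚ T) (ℕtoℚ-* 5 d))) ⟩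
  ℕtoℚ 5 * ℕtoℚ d * ℕtoℚ T * ℕtoℚ C
    ≤⟨ ℚ.*-monoʳ-≤-nonNeg (ℕtoℚ C) {{ℕtoℚ-nonNeg C}} (ℚ.*-monoʳ-≤-nonNeg (ℕtoℚ T) {{ℕtoℚ-nonNeg T}}
         (ℚ.*-monoˡ-≤-nonNeg (ℕtoℚ 5) {{ℕtoℚ-nonNeg 5}} d≤δn)) ⟩
  -- ℕtoℚ 5 and ℕtoℚ 8 * (+ 5 / 8) are closed terms with the same normal form.
  ℕtoℚ 8 * (+ 5 / 8) * (δ * ℕtoℚ (suc n)) * ℕtoℚ T * ℕtoℚ C
    ≡⟨ regroup (ℕtoℚ 8) (+ 5 / 8) δ (ℕtoℚ (suc n)) (ℕtoℚ T) (ℕtoℚ C) ⟩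
  ℕtoℚ 8 * ℕtoℚ (suc n) * ((+ 5 / 8) * δ * ℕtoℚ T * ℕtoℚ C)
    ≡⟨ cong (_* _) (ℕtoℚ-* 8 (suc n)) ⟨
  ℕtoℚ (8 ℕ.* suc n) * ((+ 5 / 8) * δ * ℕtoℚ T * ℕtoℚ C) ∎)
  where
  open ℚ.≤-Reasoning
  regroup : ∀ e f d n t c → e * f * (d * n) * t * c ≡ e * n * (f * d * t * c)
  regroup = solve 6 (λ e f d n t c → e :* f :* (d :* n) :* t :* c := e :* n :* (f :* d :* t :* c)) refl
    where open +-*-Solver

lemma2p1 : (δ : ℚ) → 0ℚ < δ → (t n : ℕ) → 1 Data.Nat.≤ t → 1 Data.Nat.≤ n →
    (c : EdgeColoring n) →
    (∀ (x : Fin n) (i : ℕ) → ℕtoℚ (deg c x i) ≤ δ * ℕtoℚ n) →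
    (L : List (Subset n)) → Unique L →
    All (λ S → IsKt t S × ¬ Rainbow c S) L →
    ℕtoℚ (length L) ≤ (+ 5 / 8) * δ * ℕtoℚ (t ^ 4) * ℕtoℚ (n C t)
lemma2p1 δ _ t (suc n) _ _ c deg≤δn L u hyp =
  scale-to-ℚ {δ} {n} {length L} {maxDegree c} {t ^ 4} {suc n C t} (nonRainbow-count c t L u hyp) maxDegree≤δn
  where
  maxDegree≤δn : ℕtoℚ (maxDegree c) ≤ δ * ℕtoℚ (suc n)
  maxDegree≤δn = maxDegree-bounded c {P = λ d → ℕtoℚ d ≤ δ * ℕtoℚ (suc n)}
                   (ℚ.≤-trans (ℕtoℚ-mono-≤ {b = deg c zero 0} z≤n) (deg≤δn zero 0)) deg≤δn
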